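{- Let $G$ be a finite bipartite planar graph, embedded in the plane, that has a perfect matching. For any face $F=(M_F,C_F)$ of $\mathcal{C}(G)$, the graph $G_F$ is bipartite.
   Context: An elementary cycle (elementary region) of the embedded planar graph $G=(V,E)$ is a cycle of $G$ bounding a single bounded face. A tiling of $G$ is a partition of $V$ into blocks each of which is either an edge of $G$ or the vertex set of an elementary cycle. The cubical matching complex $\mathcal{C}(G)$ has as faces the pairs $F=(M_F,C_F)$, with $C_F$ a set of pairwise vertex-disjoint elementary cycles and $M_F$ a perfect matching of $G$ minus the vertices of the cycles in $C_F$. The weak dual $G^\circ$ has the bounded regions of $G$ as vertices, two being adjacent iff they share an edge. $\mathcal{R}_F$ is the set of elementary regions of $G$ for which every second edge of the boundary cycle is contained in $M_F$, and $G_F$ is the subgraph of $G^\circ$ induced by $\mathcal{R}_F$. -}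

module Defs where

-- Plane graphs are modelled combinatorially (combinatorial maps / rotation
-- systems), which is the standard discrete description of a graph embedded
-- in the plane (up to homeomorphism).

open import Data.Nat using (ℕ; zero; suc; _+_; _*_; _≤ᵇ_)
open import Data.Bool using (Bool; true; false; _∨_; _∧_; not; if_then_else_)
open import Data.Fin using (Fin; toℕ; _≟_)
import Data.Fin as F
open import Data.Product using (Σ; ∃; _×_; _,_; proj₁)
open import Data.Empty using (⊥)
open import Relation.Binary.PropositionalEquality using (_≡_; _≢_)
open import Relation.Nullary using (¬_)
open import Relation.Nullary.Decidable using (⌊_⌋)
open import Data.Sum using (_⊎_)
open import Relation.Binary.Construct.Closure.ReflexiveTransitive using (Star)

iter : ∀ {A : Set} → (A → A) → ℕ → A → A
iter f zero    x = x
iter f (suc k) x = f (iter f k x)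

SameOrbit : ∀ {A : Set} → (A → A) → A → A → Set
SameOrbit f x y = ∃ λ k → iter f k x ≡ y

countF : ∀ {d} → (Fin d → Bool) → ℕ
countF {zero}  p = 0
countF {suc d} p = (if p F.zero then 1 else 0) + countF (λ i → p (F.suc i))

allF : ∀ {d} → (Fin d → Bool) → Bool
allF {zero}  p = true
allF {suc d} p = p F.zero ∧ allF (λ i → p (F.suc i))

anyF : ∀ {d} → (Fin d → Bool) → Bool
anyF {zero}  p = false
anyF {suc d} p = p F.zero ∨ anyF (λ i → p (F.suc i))

-- decidable orbit relation for a permutation of Fin d (orbits have size ≤ d)
orbB : ∀ {d} → (Fin d → Fin d) → Fin d → Fin d → Bool
orbB {d} f x y = anyF (λ (k : Fin (suc d)) → ⌊ iter f (toℕ k) x ≟ y ⌋)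

isLeastB : ∀ {d} → (Fin d → Fin d → Bool) → Fin d → Bool
isLeastB r x = allF (λ z → not (r x z) ∨ (toℕ x ≤ᵇ toℕ z))

numOrbits : ∀ {d} → (Fin d → Fin d) → ℕ
numOrbits f = countF (isLeastB (orbB f))

-- connected components of the map generated by σ and α (computed by
-- d rounds of closure, which suffices on d darts)
compB : ∀ {d} → (σinv α : Fin d → Fin d) → ℕ → Fin d → Fin d → Bool
compB σinv α zero    x y = ⌊ x ≟ y ⌋
compB σinv α (suc k) x y =
  compB σinv α k x y ∨ compB σinv α k x (σinv y) ∨ compB σinv α k x (α y)

-- A finite simple graph embedded in the plane, given by a combinatorial map:
-- darts Fin d, α pairs the two darts of each edge, σ is the rotation
-- (cyclic order of darts around each vertex), vert gives the vertex of a dart.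
-- Faces are the orbits of φ = σ ∘ α.  Genus 0 of every component is imposed by
-- the Euler formula  V + F = E + 2c  (V = σ-orbits, E = α-orbits, F = φ-orbits,
-- c = components).  In each component exactly one face is the unbounded one
-- (marked by `outer`).
record PlaneGraph : Set where
  field
    n d   : ℕ
    vert  : Fin d → Fin n
    α     : Fin d → Fin d
    σ     : Fin d → Fin d
    σinv  : Fin d → Fin d
    α-invol : ∀ x → α (α x) ≡ x
    α-nofix : ∀ x → α x ≢ x
    σ-left  : ∀ x → σinv (σ x) ≡ x
    σ-right : ∀ x → σ (σinv x) ≡ x
    σ-vert  : ∀ x → vert (σ x) ≡ vert x
    σ-trans : ∀ x y → vert x ≡ vert y → SameOrbit σ x y
    no-loop  : ∀ x → vert (α x) ≢ vert x
    no-multi : ∀ x y → vert x ≡ vert y → vert (α x) ≡ vert (α y) → x ≡ y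

  φ : Fin d → Fin d
  φ x = σ (α x)

  Step : Fin d → Fin d → Set
  Step x y = (y ≡ σ x) ⊎ (y ≡ α x)

  Conn : Fin d → Fin d → Set
  Conn = Star Step

  field
    planar : numOrbits σ + numOrbits φ ≡ numOrbits α + 2 * countF (isLeastB (compB σinv α d))
    outer       : Fin d → Bool
    outer-φ     : ∀ x → outer (φ x) ≡ outer x
    outer-exist : ∀ x → ∃ λ y → Conn x y × outer y ≡ true
    outer-unique : ∀ x y → Conn x y → outer x ≡ true → outer y ≡ true → SameOrbit φ x y

module _ (G : PlaneGraph) where
  open PlaneGraph G

  Bipartite : Set
  Bipartite = ∃ λ (col : Fin n → Bool) → ∀ x → col (vert x) ≢ col (vert (α x))

  -- the face (φ-orbit) of dart x is an elementary region: a bounded face whose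
  -- boundary walk is a cycle (length ≥ 3, no repeated vertex)
  Elementary : Fin d → Set
  Elementary x = (outer x ≡ false)
               × (φ x ≢ x) × (iter φ 2 x ≢ x)
               × (∀ i j → vert (iter φ i x) ≡ vert (iter φ j x) → iter φ i x ≡ iter φ j x)

  EdgeSet : Set
  EdgeSet = Σ (Fin d → Bool) λ M → ∀ x → M (α x) ≡ M x

  PerfectMatchingAvoiding : (Fin n → Set) → (Fin d → Bool) → Set
  PerfectMatchingAvoiding removed M =
    ∀ v → (removed v → ∀ x → vert x ≡ v → M x ≡ false)
        × (¬ removed v → Σ (Fin d) λ x → (vert x ≡ v × M x ≡ true)
                          × (∀ y → vert y ≡ v → M y ≡ true → y ≡ x))

  HasPerfectMatching : Set
  HasPerfectMatching = Σ EdgeSet λ M →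
    PerfectMatchingAvoiding (λ _ → ⊥) (proj₁ M)

  -- a face F = (M_F , C_F) of the cubical matching complex C(G);
  -- C_F is a φ-closed set of darts, i.e. a set of faces, each elementary,
  -- pairwise vertex-disjoint
  record CubeFace : Set where
    field
      M     : Fin d → Bool
      M-α   : ∀ x → M (α x) ≡ M x
      C     : Fin d → Bool
      C-φ   : ∀ x → C x ≡ true → C (φ x) ≡ true
      C-elem : ∀ x → C x ≡ true → Elementary x
      C-disj : ∀ x y → C x ≡ true → C y ≡ true → vert x ≡ vert y → SameOrbit φ x y
      M-perf : PerfectMatchingAvoiding (λ v → ∃ λ x → C x ≡ true × vert x ≡ v) M

  module _ (Fc : CubeFace) where
    open CubeFace Fc

    -- the region of x belongs to R_F: elementary, and every second edge of
    -- its boundary cycle is in M_F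
    InR : Fin d → Set
    InR x = Elementary x × ∃ λ y → SameOrbit φ x y × (∀ j → M (iter φ (2 * j) y) ≡ true)

    -- adjacency in the weak dual: distinct bounded regions sharing an edge
    Adjacent : Fin d → Fin d → Set
    Adjacent x y = ¬ SameOrbit φ x y × ∃ λ z → SameOrbit φ x z × SameOrbit φ y (α z)

    BipartiteGF : Set
    BipartiteGF = ∃ λ (col : Fin d → Bool) →
        (∀ x y → InR x → InR y → SameOrbit φ x y → col x ≡ col y)
      × (∀ x y → InR x → InR y → Adjacent x y → col x ≢ col y)

-- Colour each dart by (whether its edge lies in M_F) xor (colour of its vertex in a
-- 2-colouring of G).  The two darts of an edge get opposite colours.  Along the
-- boundary of a region of R_F the edges of M_F alternate: the even ones are matched
-- by assumption, and two consecutive matched edges would share a vertex, hence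
-- coincide, so the boundary walk would revisit a vertex after two steps, which an
-- elementary cycle does not do.  Walking one step along an alternating boundary flips
-- both summands, so the colour is constant on each region of R_F, and two regions
-- sharing an edge see its two darts, which have opposite colours.
module Submission where

open import Defs
open import Data.Nat using (zero; suc; _+_; _*_)
open import Data.Nat.Properties using (+-comm; +-suc; *-suc; n<1+n; m≤n⇒∃[o]m+o≡n)
open import Data.Bool using (Bool; true; false; not; _xor_)
open import Data.Bool.Properties using (¬-not; not-¬; not-distribʳ-xor; xor-annihilates-not)
open import Data.Fin using (Fin; toℕ)
open import Data.Fin.Properties using (pigeonhole)
open import Data.Product using (∃; _×_; _,_; proj₁; proj₂)
open import Data.Sum using (_⊎_; inj₁; inj₂)
open import Function.Base using (_∘_)
open import Function.Definitions using (Injective)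
open import Relation.Binary.PropositionalEquality
open import Relation.Nullary using (¬_)

iter-+ : ∀ {A : Set} (f : A → A) m n x → iter f (m + n) x ≡ iter f m (iter f n x)
iter-+ f zero    n x = refl
iter-+ f (suc m) n x = cong f (iter-+ f m n x)

iter-injective : ∀ {A : Set} {f : A → A} → Injective _≡_ _≡_ f →
                 ∀ m → Injective _≡_ _≡_ (iter f m)
iter-injective f-inj zero    eq = eq
iter-injective f-inj (suc m) eq = iter-injective f-inj m (f-inj eq)

iter-period-multiple : ∀ {A : Set} (f : A → A) p x → iter f (suc p) x ≡ x →
                       ∀ k → iter f (k * suc p) x ≡ x
iter-period-multiple f p x fixed zero    = refl
iter-period-multiple f p x fixed (suc k) = begin
  iter f (suc p + k * suc p) x          ≡⟨ iter-+ f (suc p) (k * suc p) x ⟩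
  iter f (suc p) (iter f (k * suc p) x) ≡⟨ cong (iter f (suc p)) (iter-period-multiple f p x fixed k) ⟩
  iter f (suc p) x                      ≡⟨ fixed ⟩
  x                                     ∎
  where open ≡-Reasoning

iter-invariant : ∀ {A B : Set} (g : A → B) (f : A → A) x →
                 (∀ k → g (f (iter f k x)) ≡ g (iter f k x)) →
                 ∀ k → g (iter f k x) ≡ g x
iter-invariant g f x step zero    = refl
iter-invariant g f x step (suc k) = trans (step k) (iter-invariant g f x step k)

-- Among x, f x, …, f^d x two coincide; injectivity cancels the common prefix.
iter-periodic : ∀ {d} {f : Fin d → Fin d} → Injective _≡_ _≡_ f →
                ∀ x → ∃ λ p → iter f (suc p) x ≡ x
iter-periodic {d} {f} f-inj x
  with i , j , i<j , fⁱx≡fʲx ← pigeonhole (n<1+n d) (λ (i : Fin (suc d)) → iter f (toℕ i) x)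
  with k , i+1+k≡j ← m≤n⇒∃[o]m+o≡n i<j
  = k , iter-injective f-inj (toℕ i) (begin
      iter f (toℕ i) (iter f (suc k) x) ≡⟨ iter-+ f (toℕ i) (suc k) x ⟨
      iter f (toℕ i + suc k) x          ≡⟨ cong (λ t → iter f t x) (trans (+-suc (toℕ i) k) i+1+k≡j) ⟩
      iter f (toℕ j) x                  ≡⟨ fⁱx≡fʲx ⟨
      iter f (toℕ i) x                  ∎)
  where open ≡-Reasoning

SameOrbit-trans : ∀ {A : Set} {f : A → A} {x y z} →
                  SameOrbit f x y → SameOrbit f y z → SameOrbit f x z
SameOrbit-trans {f = f} {x} (a , refl) (b , refl) = b + a , iter-+ f b a x

SameOrbit-sym : ∀ {d} {f : Fin d → Fin d} → Injective _≡_ _≡_ f →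
                ∀ {x y} → SameOrbit f x y → SameOrbit f y x
SameOrbit-sym {f = f} f-inj {x} (k , refl)
  with p , fixed ← iter-periodic f-inj x
  = k * p , (begin
      iter f (k * p) (iter f k x) ≡⟨ iter-+ f (k * p) k x ⟨
      iter f (k * p + k) x        ≡⟨ cong (λ t → iter f t x) (trans (+-comm (k * p) k) (sym (*-suc k p))) ⟩
      iter f (k * suc p) x        ≡⟨ iter-period-multiple f p x fixed k ⟩
      x                           ∎)
  where open ≡-Reasoning

even-or-odd : ∀ k → ∃ λ j → k ≡ 2 * j ⊎ k ≡ suc (2 * j)
even-or-odd zero = 0 , inj₁ refl
even-or-odd (suc k) with even-or-odd k
... | j , inj₁ refl = j , inj₂ refl
... | j , inj₂ refl = suc j , inj₁ (sym (*-suc 2 j))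

module _ (G : PlaneGraph) where
  open PlaneGraph G

  φ-injective : Injective _≡_ _≡_ φ
  φ-injective {a} {b} σαa≡σαb = begin
    a             ≡⟨ α-invol a ⟨
    α (α a)       ≡⟨ cong α (trans (sym (σ-left (α a))) (trans (cong σinv σαa≡σαb) (σ-left (α b)))) ⟩
    α (α b)       ≡⟨ α-invol b ⟩
    b             ∎
    where open ≡-Reasoning

  elementary-no-vertex-repeat-after-two : ∀ {x} → Elementary G x →
    ∀ m → vert (iter φ (2 + m) x) ≢ vert (iter φ m x)
  elementary-no-vertex-repeat-after-two {x} (_ , _ , φ²x≢x , vert-injective) m same-vertex =
    φ²x≢x (iter-injective φ-injective m (begin
      iter φ m (iter φ 2 x) ≡⟨ iter-+ φ m 2 x ⟨
      iter φ (m + 2) x      ≡⟨ cong (λ t → iter φ t x) (+-comm m 2) ⟩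
      iter φ (2 + m) x      ≡⟨ vert-injective (2 + m) m same-vertex ⟩
      iter φ m x            ∎))
    where open ≡-Reasoning

  module _ (Fc : CubeFace G) where
    open CubeFace Fc

    matched-dart-unique : ∀ {a b} → vert a ≡ vert b → M a ≡ true → M b ≡ true → a ≡ b
    matched-dart-unique {a} {b} same-vertex Ma Mb =
      trans (unique a same-vertex Ma) (sym (unique b refl Mb))
      where
      not-removed : ¬ (∃ λ z → C z ≡ true × vert z ≡ vert b)
      not-removed removed with () ← trans (sym Mb) (proj₁ (M-perf (vert b)) removed b refl)

      unique : ∀ z → vert z ≡ vert b → M z ≡ true → z ≡ proj₁ (proj₂ (M-perf (vert b)) not-removed)
      unique = proj₂ (proj₂ (proj₂ (M-perf (vert b)) not-removed))

    consecutive-matched⇒φ≡α : ∀ {u} → M u ≡ true → M (φ u) ≡ true → φ u ≡ α u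
    consecutive-matched⇒φ≡α {u} Mu Mφu = matched-dart-unique (σ-vert (α u)) Mφu (trans (M-α u) Mu)

    elementary-no-consecutive-matched : ∀ {x u} → Elementary G x → SameOrbit φ x u →
                                        M u ≡ true → M (φ u) ≢ true
    elementary-no-consecutive-matched {u = u} el (m , refl) Mu Mφu =
      elementary-no-vertex-repeat-after-two el m (trans (cong vert φ²u≡σu) (σ-vert _))
      where
      φ²u≡σu : φ (φ u) ≡ σ u
      φ²u≡σu = trans (cong (λ t → σ (α t)) (consecutive-matched⇒φ≡α Mu Mφu)) (cong σ (α-invol _))

    alternating-boundary : ∀ {x y} → Elementary G x → SameOrbit φ x y →
                           (∀ j → M (iter φ (2 * j) y) ≡ true) →
                           ∀ k → M (iter φ (suc k) y) ≡ not (M (iter φ k y))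
    alternating-boundary {y = y} el x~y matched-even k = alternate k (even-or-odd k)
      where
      unmatched-odd : ∀ j → M (iter φ (suc (2 * j)) y) ≡ false
      unmatched-odd j = ¬-not (elementary-no-consecutive-matched el
                          (SameOrbit-trans x~y (2 * j , refl)) (matched-even j))

      matched-even′ : ∀ j → M (iter φ (suc (suc (2 * j))) y) ≡ true
      matched-even′ j = trans (cong (λ t → M (iter φ t y)) (sym (*-suc 2 j))) (matched-even (suc j))

      alternate : ∀ k → (∃ λ j → k ≡ 2 * j ⊎ k ≡ suc (2 * j)) →
                  M (iter φ (suc k) y) ≡ not (M (iter φ k y))
      alternate _ (j , inj₁ refl) = trans (unmatched-odd j) (cong not (sym (matched-even j)))
      alternate _ (j , inj₂ refl) = trans (matched-even′ j) (cong not (sym (unmatched-odd j)))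

    module _ (cv : Fin n → Bool) (cv-proper : ∀ x → cv (vert x) ≢ cv (vert (α x))) where

      dartColour : Fin d → Bool
      dartColour w = M w xor cv (vert w)

      cv-α : ∀ w → cv (vert (α w)) ≡ not (cv (vert w))
      cv-α w = ¬-not (cv-proper w ∘ sym)

      dartColour-α : ∀ w → dartColour (α w) ≡ not (dartColour w)
      dartColour-α w =
        trans (cong₂ _xor_ (M-α w) (cv-α w)) (sym (not-distribʳ-xor (M w) (cv (vert w))))

      dartColour-φ : ∀ {u} → M (φ u) ≡ not (M u) → dartColour (φ u) ≡ dartColour u
      dartColour-φ {u} M-flips =
        trans (cong₂ _xor_ M-flips (trans (cong cv (σ-vert (α u))) (cv-α u)))
              (xor-annihilates-not (M u) (cv (vert u)))

      dartColour-constant-on-region : ∀ {x w} → InR G Fc x → SameOrbit φ x w →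
                                      dartColour w ≡ dartColour x
      dartColour-constant-on-region {x} (el , y , x~y , matched-even) x~w =
        trans (along-boundary (SameOrbit-trans y~x x~w)) (sym (along-boundary y~x))
        where
        y~x : SameOrbit φ y x
        y~x = SameOrbit-sym φ-injective x~y

        along-boundary : ∀ {w} → SameOrbit φ y w → dartColour w ≡ dartColour y
        along-boundary (k , refl) = iter-invariant dartColour φ y
          (λ k → dartColour-φ (alternating-boundary el x~y matched-even k)) k

      dartColour-adjacent : ∀ {x y} → InR G Fc x → InR G Fc y → Adjacent G Fc x y →
                            dartColour x ≢ dartColour y
      dartColour-adjacent {x} {y} x∈R y∈R (_ , z , x~z , y~αz) same-colour =
        not-¬ refl (begin
          dartColour z     ≡⟨ dartColour-constant-on-region x∈R x~z ⟩
          dartColour x     ≡⟨ same-colour ⟩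
          dartColour y     ≡⟨ dartColour-constant-on-region y∈R y~αz ⟨
          dartColour (α z) ≡⟨ dartColour-α z ⟩
          not (dartColour z) ∎)
        where open ≡-Reasoning

theorem2p3 : (G : PlaneGraph) → Bipartite G → HasPerfectMatching G →
    (Fc : CubeFace G) → BipartiteGF G Fc
theorem2p3 G (cv , cv-proper) _ Fc =
    dartColour G Fc cv cv-proper
  , (λ _ _ x∈R _ x~y → sym (dartColour-constant-on-region G Fc cv cv-proper x∈R x~y))
  , (λ _ _ → dartColour-adjacent G Fc cv cv-proper)
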